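{- Let $P$ be a finite poset and let $I\in\mathcal{IC}(P)$ be an interval-closed set of $P$. Then \[ \mathrm{Row}(I)=\mathrm{Inc}(I)\ \cup\ \Big(\Delta\big(\mathrm{Inc}_I(\mathrm{Ceil}(I))\big)-\big(I\cup\Delta(\mathrm{Ceil}(I))\big)\Big)\ \cup\ \Big(\Delta(\mathrm{Ceil}(I))-\Delta\big(\mathrm{Min}(I)\cap\Delta(\mathrm{Ceil}(I))\big)\Big), \] where $\mathrm{Inc}_I(\mathrm{Ceil}(I)):=I\cap \mathrm{Inc}(\mathrm{Ceil}(I))$ is the set of elements of $I$ incomparable to every element of $\mathrm{Ceil}(I)$.
   Context: Let $P$ be a finite poset. A subset $I\subseteq P$ is interval-closed if whenever $x,y\in I$ and $x\le z\le y$, then $z\in I$; $\mathcal{IC}(P)$ denotes the set of interval-closed subsets of $P$. For $x\in P$, the toggle $t_x:\mathcal{IC}(P)\to\mathcal{IC}(P)$ sends $I$ to $I\triangle\{x\}$ (add $x$ if $x\notin I$, remove it if $x\in I$) if the result is interval-closed, and to $I$ otherwise. Rowmotion is $\mathrm{Row}=t_{x_1}\circ t_{x_2}\circ\cdots\circ t_{x_N}$ where $(x_1,\dots,x_N)$ is a linear extension of $P$ (so toggles are applied from the top of the poset down, $t_{x_N}$ first); this is independent of the chosen linear extension. For $S\subseteq P$: $\Delta(S)$ is the smallest order ideal containing $S$, $\nabla(S)$ the smallest order filter containing $S$, and $\mathrm{Inc}(S)=P-(\Delta(S)\cup\nabla(S))$ is the set of elements incomparable to all elements of $S$. $\mathrm{Min}(I)$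 is the set of minimal elements of $I$. The ceiling of $I$ is $\mathrm{Ceil}(I)=\mathrm{Min}(\nabla(I)-I)$, the set of minimal elements of $\nabla(I)-I$. -}

module Defs where

open import Level using (0ℓ)
open import Data.Nat using (ℕ)
import Data.Nat as ℕ
open import Data.Bool using (Bool; true; false; not; if_then_else_)
open import Data.Fin using (Fin)
open import Data.Fin.Subset using (Subset; _∈_; _∉_)
open import Data.Fin.Subset.Properties using (_∈?_)
open import Data.Fin.Properties using (all?)
open import Data.List using (List; foldr)
open import Data.List.Base using ()
open import Data.Fin.Base using (toℕ)
open import Data.Vec using (updateAt)
open import Data.Product using (_×_; ∃; ∃-syntax; _,_)
open import Data.Sum using (_⊎_)
open import Function using (_∘_)
open import Function.Bundles using (_↔_)
open import Relation.Nullary using (¬_; Dec; does; yes; no)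
open import Relation.Nullary.Decidable using (_→-dec_)
open import Relation.Unary using (Pred)
open import Relation.Binary using (Rel; Decidable)
open import Relation.Binary.PropositionalEquality using (_≡_)
open import Relation.Binary.Structures using (IsPartialOrder)
import Data.List as L

record FinPoset (n : ℕ) : Set₁ where
  field
    _≼_            : Rel (Fin n) 0ℓ
    _≼?_           : Decidable _≼_
    isPartialOrder : IsPartialOrder _≡_ _≼_

module PosetDefs {n : ℕ} (P : FinPoset n) where
  open FinPoset P

  IntervalClosed : Subset n → Set
  IntervalClosed I = ∀ x y z → x ∈ I → y ∈ I → x ≼ z → z ≼ y → z ∈ I

  intervalClosed? : (I : Subset n) → Dec (IntervalClosed I)
  intervalClosed? I =
    all? λ x → all? λ y → all? λ z →
      (x ∈? I) →-dec ((y ∈? I) →-dec ((x ≼? z) →-dec ((z ≼? y) →-dec (z ∈? I))))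

  flip : Fin n → Subset n → Subset n
  flip x I = updateAt I x not

  toggle : Fin n → Subset n → Subset n
  toggle x I = if does (intervalClosed? (flip x I)) then flip x I else I

  -- a linear extension (x₁,…,x_N), given as the bijection i ↦ x_{i+1}
  record LinearExtension : Set where
    field
      elt       : Fin n ↔ Fin n
    open Function.Bundles.Inverse elt public using (to)
    field
      monotone  : ∀ i j → to i ≼ to j → toℕ i ℕ.≤ toℕ j

  -- Row = t_{x₁} ∘ t_{x₂} ∘ ⋯ ∘ t_{x_N}  (t_{x_N} applied first)
  Row : LinearExtension → Subset n → Subset n
  Row L I = foldr (λ i J → toggle (LinearExtension.to L i) J) I (L.allFin n)

  Δ : Pred (Fin n) 0ℓ → Pred (Fin n) 0ℓ
  Δ S x = ∃[ y ] (S y × x ≼ y)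

  ∇ : Pred (Fin n) 0ℓ → Pred (Fin n) 0ℓ
  ∇ S x = ∃[ y ] (S y × y ≼ x)

  Inc : Pred (Fin n) 0ℓ → Pred (Fin n) 0ℓ
  Inc S x = ¬ Δ S x × ¬ ∇ S x

  Min : Pred (Fin n) 0ℓ → Pred (Fin n) 0ℓ
  Min S x = S x × (∀ y → S y → y ≼ x → y ≡ x)

  Ceil : Pred (Fin n) 0ℓ → Pred (Fin n) 0ℓ
  Ceil I = Min (λ x → ∇ I x × ¬ I x)

  IncIn : Pred (Fin n) 0ℓ → Pred (Fin n) 0ℓ → Pred (Fin n) 0ℓ
  IncIn I S x = I x × Inc S x

  ⟦_⟧ : Subset n → Pred (Fin n) 0ℓ
  ⟦ I ⟧ x = x ∈ I

-- Toggling goes down a linear extension, so when x is toggled every element strictly above x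
-- already has its final status and every element below x still has its status in I.  Whether
-- the toggle succeeds depends only on these two neighbourhoods: an element of J can be removed
-- unless it lies strictly between two elements of J, and an element outside J can be added iff
-- the intervals from it up to members of J above, and from members below up to it, are already
-- in J.  Hence Row(I) agrees with any predicate F obeying the resulting local recurrence.  That
-- recurrence is verified for RowSpec, which splits x according to its position relative to I
-- and Ceil(I), and RowSpec rewrites to the stated formula.
module Submission where

open import Defs
open import Data.Nat using (ℕ)
open import Data.Fin using (Fin)
open import Data.Fin.Subset using (Subset; _∈_; _∉_)
open import Data.Product using (_×_)
open import Data.Sum using (_⊎_)
open import Relation.Nullary using (¬_)
open import Function.Bundles using (_⇔_)

open import Level using (0ℓ)
open import Data.Bool using (if_then_else_)
open import Data.Bool.Properties using (not-¬; ¬-not)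
open import Data.Fin using (_≟_)
import Data.Fin as Fin
import Data.Nat.Properties as ℕ
open import Data.Fin.Subset.Properties using (_∈?_)
open import Data.Fin.Properties using (any?; all?)
open import Data.Vec.Properties using ([]=⇒lookup; lookup⇒[]=; lookup∘updateAt; lookup∘updateAt′)
open import Data.Product using (∃; ∃₂; _,_; proj₁; proj₂)
open import Data.Sum using (inj₁; inj₂)
open import Data.Empty using (⊥-elim)
open import Function using (_∘_; id)
open import Function.Bundles using (mk⇔; Equivalence; Inverse)
import Function.Properties.Equivalence as ⇔
open import Data.Product.Function.NonDependent.Propositional using (_×-⇔_)
open import Data.List using (List; []; _∷_; foldr; allFin)
open import Data.List.Membership.Propositional using () renaming (_∈_ to _∈ₗ_; _∉_ to _∉ₗ_)
open import Data.List.Membership.Propositional.Properties using (∈-allFin)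
open import Data.List.Relation.Unary.Any using (here; there)
import Data.List.Relation.Unary.All as All
open import Data.List.Relation.Unary.AllPairs using (AllPairs; _∷_)
open import Data.List.Relation.Unary.AllPairs.Properties using (tabulate⁺-<)
open import Relation.Nullary using (Dec; yes; no; does)
open import Relation.Nullary.Decidable using (_×-dec_; _→-dec_; ¬?; decidable-stable)
open import Relation.Binary.PropositionalEquality
  using (_≡_; _≢_; refl; sym; trans; subst; subst₂; cong; ≢-sym)
open import Relation.Binary.Structures using (IsPartialOrder)
open import Relation.Unary using (Pred; Decidable)

open Equivalence using (to; from)

module _ {n : ℕ} (P : FinPoset n) where
  open FinPoset P
  open PosetDefs P
  open IsPartialOrder isPartialOrder using ()
    renaming (refl to ≼-refl; trans to ≼-trans; antisym to ≼-antisym)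
  open import Relation.Binary.Construct.NonStrictToStrict _≡_ _≼_
    using (_<_; <-irrefl; <-decidable)
  import Relation.Binary.Construct.NonStrictToStrict _≡_ _≼_ as Strict

  <-≼-trans : ∀ {x y z} → x < y → y ≼ z → x < z
  <-≼-trans = Strict.<-≤-trans sym ≼-trans ≼-antisym (λ { refl h → h })

  ≼-<-trans : ∀ {x y z} → x ≼ y → y < z → x < z
  ≼-<-trans = Strict.≤-<-trans ≼-trans ≼-antisym (λ { refl h → h })

  ∈-flip-self : ∀ {x J} → x ∈ flip x J ⇔ x ∉ J
  ∈-flip-self {x} {J} = mk⇔
    (λ x∈flip x∈J → not-¬ (sym ([]=⇒lookup x∈J))
                          (trans (sym ([]=⇒lookup x∈flip)) (lookup∘updateAt x J)))
    (λ x∉J → lookup⇒[]= x _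
      (trans (lookup∘updateAt x J) (sym (¬-not λ eq → x∉J (lookup⇒[]= x J (sym eq))))))

  ∈-flip-other : ∀ {x y J} → y ≢ x → y ∈ flip x J ⇔ y ∈ J
  ∈-flip-other {x} {y} {J} y≢x = mk⇔
    (λ y∈flip → lookup⇒[]= y J (trans (sym (lookup∘updateAt′ y x y≢x J)) ([]=⇒lookup y∈flip)))
    (λ y∈J → lookup⇒[]= y _ (trans (lookup∘updateAt′ y x y≢x J) ([]=⇒lookup y∈J)))

  StrictlyBetween : Pred (Fin n) 0ℓ → Pred (Fin n) 0ℓ → Pred (Fin n) 0ℓ
  StrictlyBetween A B x = ∃₂ λ a b → A a × B b × a < x × x < b

  ClosedAbove : Pred (Fin n) 0ℓ → Pred (Fin n) 0ℓ
  ClosedAbove S x = ∀ w b → x < w → w ≼ b → S b → S w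

  ClosedBelow : Pred (Fin n) 0ℓ → Pred (Fin n) 0ℓ
  ClosedBelow S x = ∀ a w → a ≼ w → w < x → S a → S w

  strictlyBetween? : ∀ (J K : Subset n) x → Dec (StrictlyBetween ⟦ J ⟧ ⟦ K ⟧ x)
  strictlyBetween? J K x = any? λ a → any? λ b →
    (a ∈? J) ×-dec (b ∈? K) ×-dec (<-decidable _≟_ _≼?_ a x) ×-dec (<-decidable _≟_ _≼?_ x b)

  flip-closed-∈ : ∀ {J x} → IntervalClosed J → x ∈ J →
                        IntervalClosed (flip x J) ⇔ (¬ StrictlyBetween ⟦ J ⟧ ⟦ J ⟧ x)
  flip-closed-∈ {J} {x} closed x∈J = mk⇔ between-absent closes
    where
    x∉flip : x ∉ flip x J
    x∉flip x∈flip = to ∈-flip-self x∈flip x∈J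

    between-absent : IntervalClosed (flip x J) → ¬ StrictlyBetween ⟦ J ⟧ ⟦ J ⟧ x
    between-absent closed′ (a , b , a∈J , b∈J , (a≼x , a≢x) , (x≼b , x≢b)) =
      x∉flip (closed′ a b x (from (∈-flip-other a≢x) a∈J) (from (∈-flip-other (≢-sym x≢b)) b∈J) a≼x x≼b)

    closes : ¬ StrictlyBetween ⟦ J ⟧ ⟦ J ⟧ x → IntervalClosed (flip x J)
    closes no-between a b z a∈flip b∈flip a≼z z≼b with a ≟ x | b ≟ x | z ≟ x
    ... | yes refl | _ | _ = ⊥-elim (x∉flip a∈flip)
    ... | no _ | yes refl | _ = ⊥-elim (x∉flip b∈flip)
    ... | no a≢x | no b≢x | yes refl = ⊥-elim (no-between
      (a , b , to (∈-flip-other a≢x) a∈flip , to (∈-flip-other b≢x) b∈flip ,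
       (a≼z , a≢x) , (z≼b , ≢-sym b≢x)))
    ... | no a≢x | no b≢x | no z≢x = from (∈-flip-other z≢x)
      (closed a b z (to (∈-flip-other a≢x) a∈flip) (to (∈-flip-other b≢x) b∈flip) a≼z z≼b)

  flip-closed-∉ : ∀ {J x} → IntervalClosed J → x ∉ J →
                        IntervalClosed (flip x J) ⇔ (ClosedAbove ⟦ J ⟧ x × ClosedBelow ⟦ J ⟧ x)
  flip-closed-∉ {J} {x} closed x∉J = mk⇔ (λ closed′ → above closed′ , below closed′) closes
    where
    x∈flip : x ∈ flip x J
    x∈flip = from ∈-flip-self x∉J

    above : IntervalClosed (flip x J) → ClosedAbove ⟦ J ⟧ x
    above closed′ w b x<w@(x≼w , x≢w) w≼b b∈J with b ≟ x
    ... | yes refl = ⊥-elim (<-irrefl refl (<-≼-trans x<w w≼b))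
    ... | no b≢x = to (∈-flip-other (≢-sym x≢w))
      (closed′ x b w x∈flip (from (∈-flip-other b≢x) b∈J) x≼w w≼b)

    below : IntervalClosed (flip x J) → ClosedBelow ⟦ J ⟧ x
    below closed′ a w a≼w w<x@(w≼x , w≢x) a∈J with a ≟ x
    ... | yes refl = ⊥-elim (<-irrefl refl (≼-<-trans a≼w w<x))
    ... | no a≢x = to (∈-flip-other w≢x)
      (closed′ a x w (from (∈-flip-other a≢x) a∈J) x∈flip a≼w w≼x)

    closes : ClosedAbove ⟦ J ⟧ x × ClosedBelow ⟦ J ⟧ x → IntervalClosed (flip x J)
    closes (up , down) a b z a∈flip b∈flip a≼z z≼b with z ≟ x
    ... | yes refl = x∈flip
    ... | no z≢x = from (∈-flip-other z≢x) (inside (a ≟ x) (b ≟ x))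
      where
      inside : Dec (a ≡ x) → Dec (b ≡ x) → z ∈ J
      inside (yes refl) (yes refl) = ⊥-elim (z≢x (≼-antisym z≼b a≼z))
      inside (yes refl) (no b≢x) = up z b (a≼z , ≢-sym z≢x) z≼b (to (∈-flip-other b≢x) b∈flip)
      inside (no a≢x) (yes refl) = down a z a≼z (z≼b , z≢x) (to (∈-flip-other a≢x) a∈flip)
      inside (no a≢x) (no b≢x) =
        closed a b z (to (∈-flip-other a≢x) a∈flip) (to (∈-flip-other b≢x) b∈flip) a≼z z≼b

  toggle-cases : ∀ x J → (IntervalClosed (flip x J) × toggle x J ≡ flip x J)
                       ⊎ (¬ IntervalClosed (flip x J) × toggle x J ≡ J)
  toggle-cases x J = cases (intervalClosed? (flip x J))
    where
    cases : ∀ {A : Set} (d : Dec A) →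
            (A × (if does d then flip x J else J) ≡ flip x J)
            ⊎ (¬ A × (if does d then flip x J else J) ≡ J)
    cases (yes a) = inj₁ (a , refl)
    cases (no ¬a) = inj₂ (¬a , refl)

  toggle-preserves-closed : ∀ {J} x → IntervalClosed J → IntervalClosed (toggle x J)
  toggle-preserves-closed {J} x closed with toggle-cases x J
  ... | inj₁ (closed′ , eq) = subst IntervalClosed (sym eq) closed′
  ... | inj₂ (_ , eq) = subst IntervalClosed (sym eq) closed

  ∈-toggle-other : ∀ {J x y} → y ≢ x → y ∈ toggle x J ⇔ y ∈ J
  ∈-toggle-other {J} {x} {y} y≢x with toggle-cases x J
  ... | inj₁ (_ , eq) rewrite eq = ∈-flip-other y≢x
  ... | inj₂ (_ , eq) rewrite eq = ⇔.refl

  ∈-toggle-self-∈ : ∀ {J x} → IntervalClosed J → x ∈ J →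
                    x ∈ toggle x J ⇔ StrictlyBetween ⟦ J ⟧ ⟦ J ⟧ x
  ∈-toggle-self-∈ {J} {x} closed x∈J with toggle-cases x J
  ... | inj₁ (closed′ , eq) rewrite eq =
    mk⇔ (λ x∈flip → ⊥-elim (to ∈-flip-self x∈flip x∈J))
        (λ between → ⊥-elim (to (flip-closed-∈ closed x∈J) closed′ between))
  ... | inj₂ (¬closed′ , eq) rewrite eq =
    mk⇔ (λ _ → decidable-stable (strictlyBetween? J J x) (¬closed′ ∘ from (flip-closed-∈ closed x∈J)))
        (λ _ → x∈J)

  ∈-toggle-self-∉ : ∀ {J x} → IntervalClosed J → x ∉ J →
                    x ∈ toggle x J ⇔ (ClosedAbove ⟦ J ⟧ x × ClosedBelow ⟦ J ⟧ x)
  ∈-toggle-self-∉ {J} {x} closed x∉J with toggle-cases x J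
  ... | inj₁ (closed′ , eq) rewrite eq =
    mk⇔ (λ _ → to (flip-closed-∉ closed x∉J) closed′) (λ _ → from ∈-flip-self x∉J)
  ... | inj₂ (¬closed′ , eq) rewrite eq =
    mk⇔ (λ x∈J → ⊥-elim (x∉J x∈J))
        (λ closedAround → ⊥-elim (¬closed′ (from (flip-closed-∉ closed x∉J) closedAround)))

  StrictlyBetween-local : ∀ {A A′ B B′ x} →
                          (∀ {y} → y < x → A y ⇔ A′ y) → (∀ {y} → x < y → B y ⇔ B′ y) →
                          StrictlyBetween A B x ⇔ StrictlyBetween A′ B′ x
  StrictlyBetween-local A⇔ B⇔ = mk⇔
    (λ (a , b , Aa , Bb , a<x , x<b) → a , b , to (A⇔ a<x) Aa , to (B⇔ x<b) Bb , a<x , x<b)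
    (λ (a , b , Aa , Bb , a<x , x<b) → a , b , from (A⇔ a<x) Aa , from (B⇔ x<b) Bb , a<x , x<b)

  ClosedAbove-local : ∀ {S S′ x} → (∀ {y} → x < y → S y ⇔ S′ y) → ClosedAbove S x ⇔ ClosedAbove S′ x
  ClosedAbove-local {S} {S′} {x} S⇔ = mk⇔ (transport S⇔) (transport (⇔.sym ∘ S⇔))
    where
    transport : ∀ {T T′} → (∀ {y} → x < y → T y ⇔ T′ y) → ClosedAbove T x → ClosedAbove T′ x
    transport T⇔ up w b x<w w≼b T′b =
      to (T⇔ x<w) (up w b x<w w≼b (from (T⇔ (<-≼-trans x<w w≼b)) T′b))

  ClosedBelow-local : ∀ {S S′ x} → (∀ {y} → y < x → S y ⇔ S′ y) → ClosedBelow S x ⇔ ClosedBelow S′ x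
  ClosedBelow-local {S} {S′} {x} S⇔ = mk⇔ (transport S⇔) (transport (⇔.sym ∘ S⇔))
    where
    transport : ∀ {T T′} → (∀ {y} → y < x → T y ⇔ T′ y) → ClosedBelow T x → ClosedBelow T′ x
    transport T⇔ down a w a≼w w<x T′a =
      to (T⇔ w<x) (down a w a≼w w<x (from (T⇔ (≼-<-trans a≼w w<x)) T′a))

  module _ (I : Subset n) (closed : IntervalClosed I) (F : Pred (Fin n) 0ℓ)
           (F-∈ : ∀ {x} → x ∈ I → F x ⇔ StrictlyBetween ⟦ I ⟧ F x)
           (F-∉ : ∀ {x} → x ∉ I → F x ⇔ (ClosedAbove F x × ClosedBelow ⟦ I ⟧ x)) where

    ∈-toggle-self : ∀ {J x} → IntervalClosed J →
                    (∀ {y} → x < y → y ∈ J ⇔ F y) → (∀ {y} → y ≼ x → y ∈ J ⇔ y ∈ I) →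
                    x ∈ toggle x J ⇔ F x
    ∈-toggle-self {J} {x} closedJ above below with x ∈? I
    ... | yes x∈I = ⇔.trans (∈-toggle-self-∈ closedJ (from (below ≼-refl) x∈I))
                   (⇔.trans (StrictlyBetween-local (below ∘ proj₁) above) (⇔.sym (F-∈ x∈I)))
    ... | no x∉I = ⇔.trans (∈-toggle-self-∉ closedJ (x∉I ∘ to (below ≼-refl)))
                   (⇔.trans (ClosedAbove-local above ×-⇔ ClosedBelow-local (below ∘ proj₁))
                            (⇔.sym (F-∉ x∉I)))

    module _ (L : LinearExtension) where
      open LinearExtension L using (elt; monotone) renaming (to to element)

      position : Fin n → Fin n
      position = Inverse.from elt

      position-monotone : ∀ {y z} → y ≼ z → position y Fin.≤ position z
      position-monotone {y} {z} y≼z = monotone (position y) (position z)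
        (subst₂ _≼_ (sym (Inverse.strictlyInverseˡ elt y)) (sym (Inverse.strictlyInverseˡ elt z)) y≼z)

      Toggled : List (Fin n) → Subset n
      Toggled = foldr (λ i J → toggle (element i) J) I

      UpwardClosed : List (Fin n) → Set
      UpwardClosed ps = ∀ {y z} → y ≼ z → position y ∈ₗ ps → position z ∈ₗ ps

      record Matches (ps : List (Fin n)) (J : Subset n) : Set where
        field
          isClosed  : IntervalClosed J
          toggled   : ∀ {y} → position y ∈ₗ ps → y ∈ J ⇔ F y
          untoggled : ∀ {y} → position y ∉ₗ ps → y ∈ J ⇔ y ∈ I

      toggled-matches : ∀ ps → AllPairs Fin._<_ ps → UpwardClosed ps → Matches ps (Toggled ps)
      toggled-matches [] _ _ = record { isClosed = closed ; toggled = λ () ; untoggled = λ _ → ⇔.refl }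
      toggled-matches (i ∷ ps) (i<ps ∷ sorted) upward = record
        { isClosed  = toggle-preserves-closed x (Matches.isClosed IH)
        ; toggled   = toggled
        ; untoggled = untoggled
        }
        where
        x : Fin n
        x = element i

        position-x : position x ≡ i
        position-x = Inverse.strictlyInverseʳ elt i

        ≡x : ∀ {y} → position y ≡ i → y ≡ x
        ≡x {y} eq = trans (sym (Inverse.strictlyInverseˡ elt y)) (cong element eq)

        after : ∀ {y} → position y ∈ₗ ps → i Fin.< position y
        after = All.lookup i<ps

        below-untoggled : ∀ {y} → y ≼ x → position y ∉ₗ ps
        below-untoggled y≼x p∈ps =
          ℕ.<⇒≱ (after p∈ps) (subst (position _ Fin.≤_) position-x (position-monotone y≼x))

        above-toggled : ∀ {y} → x < y → position y ∈ₗ ps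
        above-toggled (x≼y , x≢y) with upward x≼y (here position-x)
        ... | here eq = ⊥-elim (x≢y (sym (≡x eq)))
        ... | there p∈ps = p∈ps

        upward′ : UpwardClosed ps
        upward′ y≼z py∈ps with upward y≼z (there py∈ps)
        ... | here eq =
          ⊥-elim (ℕ.<⇒≱ (after py∈ps) (subst (position _ Fin.≤_) eq (position-monotone y≼z)))
        ... | there pz∈ps = pz∈ps

        IH : Matches ps (Toggled ps)
        IH = toggled-matches ps sorted upward′
        open Matches IH using () renaming (toggled to toggledᴵᴴ; untoggled to untoggledᴵᴴ)

        toggled : ∀ {y} → position y ∈ₗ i ∷ ps → y ∈ toggle x (Toggled ps) ⇔ F y
        toggled (here eq) rewrite ≡x eq =
          ∈-toggle-self (Matches.isClosed IH) (toggledᴵᴴ ∘ above-toggled) (untoggledᴵᴴ ∘ below-untoggled)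
        toggled {y} (there p∈ps) with y ≟ x
        ... | yes refl = ⊥-elim (below-untoggled ≼-refl p∈ps)
        ... | no y≢x = ⇔.trans (∈-toggle-other y≢x) (toggledᴵᴴ p∈ps)

        untoggled : ∀ {y} → position y ∉ₗ i ∷ ps → y ∈ toggle x (Toggled ps) ⇔ y ∈ I
        untoggled {y} p∉ with y ≟ x
        ... | yes refl = ⊥-elim (p∉ (here position-x))
        ... | no y≢x = ⇔.trans (∈-toggle-other y≢x) (untoggledᴵᴴ (p∉ ∘ there))

      ∈-Row : ∀ y → y ∈ Row L I ⇔ F y
      ∈-Row y = Matches.toggled everything-toggled (∈-allFin (position y))
        where
        everything-toggled : Matches (allFin n) (Row L I)
        everything-toggled =
          toggled-matches (allFin n) (tabulate⁺-< id) (λ {_} {z} _ _ → ∈-allFin (position z))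

  Δ? : ∀ {S} → Decidable S → Decidable (Δ S)
  Δ? S? x = any? λ y → S? y ×-dec (x ≼? y)

  ∇? : ∀ {S} → Decidable S → Decidable (∇ S)
  ∇? S? x = any? λ y → S? y ×-dec (y ≼? x)

  Min? : ∀ {S} → Decidable S → Decidable (Min S)
  Min? S? x = S? x ×-dec all? λ y → S? y →-dec ((y ≼? x) →-dec (y ≟ x))

  ¬Min⇒∃< : ∀ {S x} → Decidable S → S x → ¬ Min S x → ∃ λ a → S a × a < x
  ¬Min⇒∃< {S} {x} S? Sx ¬Min = decidable-stable (any? λ a → S? a ×-dec <-decidable _≟_ _≼?_ a x)
    λ none → ¬Min (Sx , λ y Sy y≼x → decidable-stable (y ≟ x) λ y≢x → none (y , Sy , y≼x , y≢x))

  module _ (I : Subset n) (closed : IntervalClosed I) where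
    I? : Decidable ⟦ I ⟧
    I? x = x ∈? I

    C : Pred (Fin n) 0ℓ
    C = Ceil ⟦ I ⟧

    C? : Decidable C
    C? = Min? λ x → ∇? I? x ×-dec ¬? (I? x)

    MinBelowCeil : Pred (Fin n) 0ℓ
    MinBelowCeil y = Min ⟦ I ⟧ y × Δ C y

    RowSpec : Pred (Fin n) 0ℓ
    RowSpec x = (x ∈ I × Δ C x × ¬ Min ⟦ I ⟧ x)
              ⊎ C x
              ⊎ (x ∉ I × ¬ ∇ ⟦ I ⟧ x × Δ ⟦ I ⟧ x × ¬ Δ MinBelowCeil x)
              ⊎ Inc ⟦ I ⟧ x

    ∇∩Δ⇒∈ : ∀ {x} → ∇ ⟦ I ⟧ x → Δ ⟦ I ⟧ x → x ∈ I
    ∇∩Δ⇒∈ {x} (a , a∈I , a≼x) (b , b∈I , x≼b) = closed a b x a∈I b∈I a≼x x≼b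

    C⇒∉ : ∀ {c} → C c → c ∉ I
    C⇒∉ ((_ , c∉I) , _) = c∉I

    C-minimal : ∀ {c y} → C c → ∇ ⟦ I ⟧ y → y ∉ I → y ≼ c → y ≡ c
    C-minimal (_ , minimal) ∇y y∉I y≼c = minimal _ (∇y , y∉I) y≼c

    RowSpec-∇ : ∀ {b} → RowSpec b → ∇ ⟦ I ⟧ b → (b ∈ I × Δ C b × ¬ Min ⟦ I ⟧ b) ⊎ C b
    RowSpec-∇ (inj₁ h) _ = inj₁ h
    RowSpec-∇ (inj₂ (inj₁ Cb)) _ = inj₂ Cb
    RowSpec-∇ (inj₂ (inj₂ (inj₁ (_ , ¬∇b , _)))) ∇b = ⊥-elim (¬∇b ∇b)
    RowSpec-∇ (inj₂ (inj₂ (inj₂ (_ , ¬∇b)))) ∇b = ⊥-elim (¬∇b ∇b)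

    RowSpec-below-∈ : ∀ {x b} → RowSpec b → x ≼ b → x ∈ I → Δ C x
    RowSpec-below-∈ {x} {b} Rb x≼b x∈I with RowSpec-∇ Rb (x , x∈I , x≼b)
    ... | inj₁ (_ , (c , Cc , b≼c) , _) = c , Cc , ≼-trans x≼b b≼c
    ... | inj₂ Cb = b , Cb , x≼b

    RowSpec-below-∉ : ∀ {w b} → w ∉ I → ∇ ⟦ I ⟧ w → w ≼ b → RowSpec b → C w
    RowSpec-below-∉ w∉I ∇w@(i , i∈I , i≼w) w≼b Rb with RowSpec-∇ Rb (i , i∈I , ≼-trans i≼w w≼b)
    ... | inj₁ (b∈I , _) = ⊥-elim (w∉I (∇∩Δ⇒∈ ∇w (_ , b∈I , w≼b)))
    ... | inj₂ Cb = subst C (sym (C-minimal Cb ∇w w∉I w≼b)) Cb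

    Min∉RowSpec : ∀ {m} → Min ⟦ I ⟧ m → ¬ RowSpec m
    Min∉RowSpec Min-m (inj₁ (_ , _ , ¬Min-m)) = ¬Min-m Min-m
    Min∉RowSpec (m∈I , _) (inj₂ (inj₁ Cm)) = C⇒∉ Cm m∈I
    Min∉RowSpec (m∈I , _) (inj₂ (inj₂ (inj₁ (m∉I , _)))) = m∉I m∈I
    Min∉RowSpec (m∈I , _) (inj₂ (inj₂ (inj₂ (¬Δm , _)))) = ¬Δm (_ , m∈I , ≼-refl)

    RowSpec-∈ : ∀ {x} → x ∈ I → RowSpec x ⇔ StrictlyBetween ⟦ I ⟧ RowSpec x
    RowSpec-∈ {x} x∈I = mk⇔ between row
      where
      between : RowSpec x → StrictlyBetween ⟦ I ⟧ RowSpec x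
      between (inj₁ (_ , (c , Cc , x≼c) , ¬Min-x)) with ¬Min⇒∃< I? x∈I ¬Min-x
      ... | a , a∈I , a<x = a , c , a∈I , inj₂ (inj₁ Cc) , a<x , x≼c , λ { refl → C⇒∉ Cc x∈I }
      between (inj₂ (inj₁ Cx)) = ⊥-elim (C⇒∉ Cx x∈I)
      between (inj₂ (inj₂ (inj₁ (x∉I , _)))) = ⊥-elim (x∉I x∈I)
      between (inj₂ (inj₂ (inj₂ (¬Δx , _)))) = ⊥-elim (¬Δx (x , x∈I , ≼-refl))

      row : StrictlyBetween ⟦ I ⟧ RowSpec x → RowSpec x
      row (a , b , a∈I , Rb , (a≼x , a≢x) , (x≼b , _)) =
        inj₁ (x∈I , RowSpec-below-∈ Rb x≼b x∈I , λ (_ , minimal) → a≢x (minimal a a∈I a≼x))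

    RowSpec⇔C : ∀ {x} → x ∉ I → ∇ ⟦ I ⟧ x → RowSpec x ⇔ C x
    RowSpec⇔C {x} x∉I ∇x = mk⇔ ceil (inj₂ ∘ inj₁)
      where
      ceil : RowSpec x → C x
      ceil (inj₁ (x∈I , _)) = ⊥-elim (x∉I x∈I)
      ceil (inj₂ (inj₁ Cx)) = Cx
      ceil (inj₂ (inj₂ (inj₁ (_ , ¬∇x , _)))) = ⊥-elim (¬∇x ∇x)
      ceil (inj₂ (inj₂ (inj₂ (_ , ¬∇x)))) = ⊥-elim (¬∇x ∇x)

    C⇔ClosedBelow : ∀ {x} → x ∉ I → ∇ ⟦ I ⟧ x → C x ⇔ ClosedBelow ⟦ I ⟧ x
    C⇔ClosedBelow {x} x∉I ∇x = mk⇔ below ceil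
      where
      below : C x → ClosedBelow ⟦ I ⟧ x
      below Cx a w a≼w (w≼x , w≢x) a∈I =
        decidable-stable (I? w) λ w∉I → w≢x (C-minimal Cx (a , a∈I , a≼w) w∉I w≼x)

      ceil : ClosedBelow ⟦ I ⟧ x → C x
      ceil down = (∇x , x∉I) , λ y ((a , a∈I , a≼y) , y∉I) y≼x →
        decidable-stable (y ≟ x) λ y≢x → y∉I (down a y a≼y (y≼x , y≢x) a∈I)

    ClosedAbove-∇ : ∀ {x} → x ∉ I → ∇ ⟦ I ⟧ x → ClosedAbove RowSpec x
    ClosedAbove-∇ {x} x∉I (i , i∈I , i≼x) w b (x≼w , _) w≼b Rb =
      inj₂ (inj₁ (RowSpec-below-∉ w∉I (i , i∈I , ≼-trans i≼x x≼w) w≼b Rb))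
      where
      w∉I : w ∉ I
      w∉I w∈I = x∉I (closed i w x i∈I w∈I i≼x x≼w)

    ClosedAbove-¬∇ : ∀ {x} → ¬ ∇ ⟦ I ⟧ x → ¬ Δ MinBelowCeil x → ClosedAbove RowSpec x
    ClosedAbove-¬∇ {x} ¬∇x ¬ΔM w b (x≼w , _) w≼b Rb with I? w | ∇? I? w | Δ? I? w
    ... | yes w∈I | _ | _ = inj₁ (w∈I , ΔCw , λ Min-w → ¬ΔM (w , (Min-w , ΔCw) , x≼w))
      where
      ΔCw : Δ C w
      ΔCw = RowSpec-below-∈ Rb w≼b w∈I
    ... | no w∉I | yes ∇w | _ = inj₂ (inj₁ (RowSpec-below-∉ w∉I ∇w w≼b Rb))
    ... | no w∉I | no ¬∇w | yes Δw =
      inj₂ (inj₂ (inj₁ (w∉I , ¬∇w , Δw , λ (m , Mm , w≼m) → ¬ΔM (m , Mm , ≼-trans x≼w w≼m))))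
    ... | no _ | no ¬∇w | no ¬Δw = inj₂ (inj₂ (inj₂ (¬Δw , ¬∇w)))

    ClosedAbove⇒¬ΔMin : ∀ {x} → x ∉ I → ClosedAbove RowSpec x → ¬ Δ MinBelowCeil x
    ClosedAbove⇒¬ΔMin x∉I up (m , (Min-m , c , Cc , m≼c) , x≼m) =
      Min∉RowSpec Min-m (up m c (x≼m , λ { refl → x∉I (proj₁ Min-m) }) m≼c (inj₂ (inj₁ Cc)))

    RowSpec⇔¬ΔMin : ∀ {x} → x ∉ I → ¬ ∇ ⟦ I ⟧ x → RowSpec x ⇔ (¬ Δ MinBelowCeil x)
    RowSpec⇔¬ΔMin {x} x∉I ¬∇x = mk⇔ ¬ΔMin row
      where
      ¬ΔMin : RowSpec x → ¬ Δ MinBelowCeil x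
      ¬ΔMin (inj₁ (x∈I , _)) = ⊥-elim (x∉I x∈I)
      ¬ΔMin (inj₂ (inj₁ Cx)) = ⊥-elim (¬∇x (proj₁ (proj₁ Cx)))
      ¬ΔMin (inj₂ (inj₂ (inj₁ (_ , _ , _ , ¬ΔM)))) = ¬ΔM
      ¬ΔMin (inj₂ (inj₂ (inj₂ (¬Δx , _)))) (m , ((m∈I , _) , _) , x≼m) = ¬Δx (m , m∈I , x≼m)

      row : ¬ Δ MinBelowCeil x → RowSpec x
      row ¬ΔM with Δ? I? x
      ... | yes Δx = inj₂ (inj₂ (inj₁ (x∉I , ¬∇x , Δx , ¬ΔM)))
      ... | no ¬Δx = inj₂ (inj₂ (inj₂ (¬Δx , ¬∇x)))

    RowSpec-∉ : ∀ {x} → x ∉ I → RowSpec x ⇔ (ClosedAbove RowSpec x × ClosedBelow ⟦ I ⟧ x)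
    RowSpec-∉ {x} x∉I with ∇? I? x
    ... | yes ∇x = ⇔.trans (RowSpec⇔C x∉I ∇x)
      (mk⇔ (λ Cx → ClosedAbove-∇ x∉I ∇x , to (C⇔ClosedBelow x∉I ∇x) Cx)
           (from (C⇔ClosedBelow x∉I ∇x) ∘ proj₂))
    ... | no ¬∇x = ⇔.trans (RowSpec⇔¬ΔMin x∉I ¬∇x)
      (mk⇔ (λ ¬ΔM → ClosedAbove-¬∇ ¬∇x ¬ΔM , vacuous) (ClosedAbove⇒¬ΔMin x∉I ∘ proj₁))
      where
      vacuous : ClosedBelow ⟦ I ⟧ x
      vacuous a w a≼w (w≼x , _) a∈I = ⊥-elim (¬∇x (a , a∈I , ≼-trans a≼w w≼x))

    RowFormula : Pred (Fin n) 0ℓ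
    RowFormula x = Inc ⟦ I ⟧ x
                 ⊎ (Δ (IncIn ⟦ I ⟧ C) x × ¬ (x ∈ I ⊎ Δ C x))
                 ⊎ (Δ C x × ¬ Δ MinBelowCeil x)

    RowSpec⇔RowFormula : ∀ x → RowSpec x ⇔ RowFormula x
    RowSpec⇔RowFormula x = mk⇔ formula row
      where
      formula : RowSpec x → RowFormula x
      formula (inj₁ (x∈I , ΔCx , ¬Min-x)) =
        inj₂ (inj₂ (ΔCx , λ (m , (Min-m , _) , x≼m) →
          ¬Min-x (subst (Min ⟦ I ⟧) (sym (proj₂ Min-m x x∈I x≼m)) Min-m)))
      formula (inj₂ (inj₁ Cx)) =
        inj₂ (inj₂ ((x , Cx , ≼-refl) , λ (m , ((m∈I , _) , _) , x≼m) →
          C⇒∉ Cx (∇∩Δ⇒∈ (proj₁ (proj₁ Cx)) (m , m∈I , x≼m))))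
      formula (inj₂ (inj₂ (inj₁ (x∉I , ¬∇x , (i , i∈I , x≼i) , ¬ΔM)))) with Δ? C? x
      ... | yes ΔCx = inj₂ (inj₂ (ΔCx , ¬ΔM))
      ... | no ¬ΔCx =
        inj₂ (inj₁ ((i , (i∈I , ¬ΔCi , ¬∇Ci) , x≼i) ,
                    λ { (inj₁ x∈I) → x∉I x∈I ; (inj₂ ΔCx) → ¬ΔCx ΔCx }))
        where
        ¬ΔCi : ¬ Δ C i
        ¬ΔCi (c , Cc , i≼c) = ¬ΔCx (c , Cc , ≼-trans x≼i i≼c)
        ¬∇Ci : ¬ ∇ C i
        ¬∇Ci (c , Cc , c≼i) = C⇒∉ Cc (∇∩Δ⇒∈ (proj₁ (proj₁ Cc)) (i , i∈I , c≼i))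
      formula (inj₂ (inj₂ (inj₂ Inc-x))) = inj₁ Inc-x

      row : RowFormula x → RowSpec x
      row (inj₁ Inc-x) = inj₂ (inj₂ (inj₂ Inc-x))
      row (inj₂ (inj₁ ((i , (i∈I , _) , x≼i) , outside))) =
        inj₂ (inj₂ (inj₁ (outside ∘ inj₁ , (λ ∇x → outside (inj₁ (∇∩Δ⇒∈ ∇x (i , i∈I , x≼i)))) ,
                          (i , i∈I , x≼i) ,
                          λ (m , (_ , c , Cc , m≼c) , x≼m) → outside (inj₂ (c , Cc , ≼-trans x≼m m≼c)))))
      row (inj₂ (inj₂ (ΔCx@(c , Cc , x≼c) , ¬ΔM))) with I? x | ∇? I? x | Δ? I? x
      ... | yes x∈I | _ | _ = inj₁ (x∈I , ΔCx , λ Min-x → ¬ΔM (x , (Min-x , ΔCx) , ≼-refl))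
      ... | no x∉I | yes ∇x | _ = inj₂ (inj₁ (subst C (sym (C-minimal Cc ∇x x∉I x≼c)) Cc))
      ... | no x∉I | no ¬∇x | yes Δx = inj₂ (inj₂ (inj₁ (x∉I , ¬∇x , Δx , ¬ΔM)))
      ... | no _ | no ¬∇x | no ¬Δx = inj₂ (inj₂ (inj₂ (¬Δx , ¬∇x)))

theorem2p20 : ∀ {n : ℕ} (P : FinPoset n) (L : PosetDefs.LinearExtension P)
              (I : Subset n) → PosetDefs.IntervalClosed P I →
              let open PosetDefs P in
              ∀ (x : Fin n) →
                (x ∈ Row L I) ⇔
                (Inc ⟦ I ⟧ x
                 ⊎ (Δ (IncIn ⟦ I ⟧ (Ceil ⟦ I ⟧)) x × ¬ (x ∈ I ⊎ Δ (Ceil ⟦ I ⟧) x))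
                 ⊎ (Δ (Ceil ⟦ I ⟧) x × ¬ Δ (λ y → Min ⟦ I ⟧ y × Δ (Ceil ⟦ I ⟧) y) x))
theorem2p20 P L I closed x =
  ⇔.trans (∈-Row P I closed (RowSpec P I closed) (RowSpec-∈ P I closed) (RowSpec-∉ P I closed) L x)
          (RowSpec⇔RowFormula P I closed x)
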